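{- Let $k\ge 1$ be an integer, let $G_2$ be an arbitrary graph and let $G_1=C_{2k+2}$ be a cycle on $2k+2$ vertices, such that $G_1$ and $G_2$ share exactly one edge (that is, $V(G_1)\cap V(G_2)$ consists of the two endpoints of a single edge lying in both $G_1$ and $G_2$). Let $G=G_1\oplus G_2$. Then $P_{DP}(G,m)<P(G,m)$ for every integer $m\geq\max\{2,\chi(G_2)\}$.
   Context: All graphs are finite and simple. If $V(G_1)\cap V(G_2)$ is nonempty and induces a clique in both $G_1$ and $G_2$, the clique-sum $G_1\oplus G_2$ is the graph with vertex set $V(G_1)\cup V(G_2)$ and edge set $E(G_1)\cup E(G_2)$. $\chi$ denotes the chromatic number. For $m\in\mathbb{N}$, $P(G,m)$ denotes the number of proper $m$-colorings of $G$. A cover of a graph $G$ is a pair $\mathcal{H}=(L,H)$ where $H$ is a graph and $L:V(G)\to\mathcal{P}(V(H))$ satisfies: (1) the sets $L(u)$, $u\in V(G)$, partition $V(H)$; (2) each $H[L(u)]$ is complete; (3) if $E_H(L(u),L(v))$ is nonempty then $u=v$ or $uv\in E(G)$; (4) if $uv\in E(G)$ then $E_H(L(u),L(v))$ is a matching (possibly empty). Here $E_H(S,U)$ is the set of edges of $H$ with one endpoint in $S$ and one in $U$. The cover is $m$-fold if $|L(u)|=m$ for all $u$. An $\mathcal{H}$-coloring of $G$ is an independent set of $H$ of size $|V(G)|$. $P_{DP}(G,\mathcal{H})$ is the number of $\mathcal{H}$-colorings, and $P_{DP}(G,m)$ is the minimum of $P_{DP}(G,\mathcal{H})$ over all $m$-fold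 covers $\mathcal{H}$ of $G$. -}

module Defs where

open import Data.Bool using (Bool; true; false; _∧_; _∨_; not)
open import Data.Nat using (ℕ; zero; suc; _+_; _*_; _%_; _<_; _≤_)
open import Data.Fin using (Fin; toℕ)
open import Data.Fin.Properties using () renaming (_≟_ to _≟ᶠ_)
open import Data.List using (List; []; _∷_; map; concatMap; length; filterᵇ; allFin)
open import Data.Vec using (Vec; []; _∷_; lookup)
open import Data.Product using (Σ; ∃; _×_; _,_)
open import Data.Sum using (_⊎_)
open import Relation.Nullary using (¬_)
open import Data.Empty using (⊥)
open import Relation.Nullary.Decidable using (⌊_⌋)
open import Relation.Binary.PropositionalEquality using (_≡_; _≢_)
open import Function.Definitions using (Injective)

record Graph (n : ℕ) : Set where
  field
    adj   : Fin n → Fin n → Bool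
    sym   : ∀ u v → adj u v ≡ adj v u
    irrefl : ∀ u → adj u u ≡ false
open Graph public

allB : {A : Set} → (A → Bool) → List A → Bool
allB p [] = true
allB p (x ∷ xs) = p x ∧ allB p xs

_==_ : ∀ {n} → Fin n → Fin n → Bool
x == y = ⌊ x ≟ᶠ y ⌋

allVecs : (m n : ℕ) → List (Vec (Fin m) n)
allVecs m zero = [] ∷ []
allVecs m (suc n) = concatMap (λ c → map (c ∷_) (allVecs m n)) (allFin m)

isProper : ∀ {n m} → Graph n → Vec (Fin m) n → Bool
isProper {n} G c =
  allB (λ u → allB (λ v → not (adj G u v) ∨ not (lookup c u == lookup c v)) (allFin n)) (allFin n)

P : ∀ {n} → Graph n → ℕ → ℕ
P {n} G m = length (filterᵇ (isProper G) (allVecs m n))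

-- A cover (L,H) of G is given by a graph H on
-- Fin M together with the map  own : Fin M → Fin n  sending each vertex
-- of H to the unique u with x ∈ L(u); thus L(u) = own⁻¹(u) and the sets
-- L(u) partition V(H) (condition (1)).

record Cover {n : ℕ} (G : Graph n) (m : ℕ) : Set where
  field
    M   : ℕ
    H   : Graph M
    own : Fin M → Fin n
    clique   : ∀ x y → x ≢ y → own x ≡ own y → adj H x y ≡ true
    edgeOK   : ∀ x y → adj H x y ≡ true →
               own x ≡ own y ⊎ adj G (own x) (own y) ≡ true
    matching : ∀ x y z → adj H x y ≡ true → adj H x z ≡ true →
               own x ≢ own y → own y ≡ own z → y ≡ z
    mfold    : ∀ u → length (filterᵇ (λ x → own x == u) (allFin M)) ≡ m
open Cover public

allSubsets : (M : ℕ) → List (Vec Bool M)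
allSubsets zero = [] ∷ []
allSubsets (suc M) = concatMap (λ b → map (b ∷_) (allSubsets M)) (true ∷ false ∷ [])

size : ∀ {M} → Vec Bool M → ℕ
size [] = 0
size (true ∷ s) = suc (size s)
size (false ∷ s) = size s

isIndependent : ∀ {M} → Graph M → Vec Bool M → Bool
isIndependent {M} H s =
  allB (λ x → allB (λ y → not (lookup s x ∧ lookup s y ∧ adj H x y)) (allFin M)) (allFin M)

_==ℕ_ : ℕ → ℕ → Bool
zero ==ℕ zero = true
zero ==ℕ suc _ = false
suc _ ==ℕ zero = false
suc a ==ℕ suc b = a ==ℕ b

PDP-cover : ∀ {n m} {G : Graph n} → Cover G m → ℕ
PDP-cover {n} 𝓗 =
  length (filterᵇ (λ s → isIndependent (H 𝓗) s ∧ (size s ==ℕ n)) (allSubsets (M 𝓗)))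

-- P_DP(G,m) < b  (P_DP(G,m) being the minimum of PDP-cover over all
-- m-fold covers): some m-fold cover has fewer than b colorings.
PDP-lt : ∀ {n} → Graph n → ℕ → ℕ → Set
PDP-lt G m b = Σ (Cover G m) (λ 𝓗 → PDP-cover 𝓗 < b)

record GraphIn (N : ℕ) : Set where
  field
    verts    : Fin N → Bool
    eadj     : Fin N → Fin N → Bool
    esym     : ∀ u v → eadj u v ≡ eadj v u
    eirrefl  : ∀ u → eadj u u ≡ false
    eInVerts : ∀ u v → eadj u v ≡ true → verts u ≡ true
open GraphIn public

-- clique-sum G1 ⊕ G2 viewed as a graph on the universe Fin N
-- (used when V(G1) ∪ V(G2) is all of Fin N)
cliqueSum : ∀ {N} → GraphIn N → GraphIn N → Graph N
cliqueSum G₁ G₂ = record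
  { adj = λ u v → eadj G₁ u v ∨ eadj G₂ u v
  ; sym = λ u v → lemma u v
  ; irrefl = λ u → lemma2 u }
  where
  open import Relation.Binary.PropositionalEquality using (cong₂; refl)
  lemma : ∀ u v → (eadj G₁ u v ∨ eadj G₂ u v) ≡ (eadj G₁ v u ∨ eadj G₂ v u)
  lemma u v = cong₂ _∨_ (esym G₁ u v) (esym G₂ u v)
  lemma2 : ∀ u → (eadj G₁ u u ∨ eadj G₂ u u) ≡ false
  lemma2 u with eadj G₁ u u | eirrefl G₁ u | eadj G₂ u u | eirrefl G₂ u
  ... | .false | refl | .false | refl = refl

cycAdj : (len : ℕ) → Fin len → Fin len → Set
cycAdj zero i j = ⊥
cycAdj (suc l) i j = toℕ j ≡ suc (toℕ i) % suc l ⊎ toℕ i ≡ suc (toℕ j) % suc l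

IsCycle : ∀ {N} → ℕ → GraphIn N → Set
IsCycle {N} len G₁ =
  Σ (Fin len → Fin N) λ φ →
    Injective _≡_ _≡_ φ ×
    (∀ i → verts G₁ (φ i) ≡ true) ×
    (∀ v → verts G₁ v ≡ true → ∃ λ i → φ i ≡ v) ×
    (∀ i j → eadj G₁ (φ i) (φ j) ≡ true → cycAdj len i j) ×
    (∀ i j → cycAdj len i j → eadj G₁ (φ i) (φ j) ≡ true)

Colorable : ∀ {N} → GraphIn N → ℕ → Set
Colorable {N} G₂ m =
  Σ (Fin N → Fin m) λ f → ∀ u v → eadj G₂ u v ≡ true → f u ≢ f v

module Submission where

-- The walk around the cycle from ab is an "even ear" of G: a closed walk
-- a = ψ 0, b = ψ 1, …, ψ n = a (n even) whose internal vertices have degree 2.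
-- We prove the inequality for any G with an even ear whose other edges are
-- m-colourable.  Twist the canonical m-fold cover on the edge b ψ₂ by σ = (0 1);
-- recolouring by σ the maximal run of colours 0/1 along the ear from b is an
-- involution sending its colourings to proper colourings, and it misses the
-- proper colouring alternating 1, 0, 1, … along the ear.

open import Defs hiding (sym)
open import Data.Nat using (ℕ; zero; suc; pred; _+_; _*_; _∸_; _%_; _≤_; _<_; _≤?_; z≤n; s≤s; NonZero)
open import Data.Nat.Properties
  using ( +-comm; +-assoc; +-suc; +-identityʳ; m+[n∸m]≡n; ≤-refl; ≤-trans; ≤-pred; ≤-antisym; <⇒≤; <-irrefl
        ; n≤1+n; m≤n⇒m<n∨m≡n; anyUpTo?; allUpTo?)
open import Data.Nat.DivMod using (%-distribˡ-+; m%n%n≡m%n; [m+n]%n≡m%n; m<n⇒m%n≡m; m%n<n)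
open import Data.Nat.GeneralisedArithmetic using (fold)
open import Data.Nat.Tactic.RingSolver using (solve-∀)
open import Data.Bool using (Bool; true; false; _∧_; _∨_; not; T?)
import Data.Bool as Bool
open import Data.Bool.Properties using (T-≡; ∨-zeroʳ)
open import Data.Fin using (Fin; zero; suc; toℕ; fromℕ<; combine; remQuot)
open import Data.Fin.Properties
  using (any?; remQuot-combine; combine-remQuot; combine-injectiveʳ; toℕ-fromℕ<; toℕ-injective; toℕ<n)
  renaming (_≟_ to _≟ᶠ_)
open import Data.Fin.Permutation.Components using (transpose; transpose-inverse)
open import Data.List using (List; []; _∷_; _++_; length; map; filterᵇ; allFin)
import Data.List as List
open import Data.List.Properties using (length-++-sucʳ; length-map; length-tabulate)
open import Data.List.Membership.Propositional using (_∈_)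
open import Data.List.Membership.Propositional.Properties
  using (∈-allFin; ∈-concatMap⁺; ∈-∃++; ∈-++⁺ˡ; ∈-++⁺ʳ; ∈-++⁻; ∈-map⁺; ∈-map⁻; ∈-filter⁺; ∈-filter⁻)
open import Data.List.Relation.Unary.Any using (here; there)
import Data.List.Relation.Unary.Any as Any
import Data.List.Relation.Unary.All as All
open import Data.List.Relation.Unary.AllPairs using ([]; _∷_)
open import Data.List.Relation.Unary.Unique.Propositional using (Unique)
import Data.List.Relation.Unary.Unique.Propositional.Properties as Unique
open import Data.Vec using (Vec; []; _∷_; lookup)
import Data.Vec as Vec
open import Data.Vec.Properties using (∷-injectiveʳ; lookup∘tabulate; tabulate∘lookup; tabulate-cong)
open import Data.Product using (Σ; ∃; _×_; _,_; proj₁; proj₂)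
open import Data.Sum using (_⊎_; inj₁; inj₂)
open import Data.Empty using (⊥; ⊥-elim)
open import Function.Base using (id; _∘_; flip)
open import Function.Bundles using (Equivalence)
open import Relation.Nullary using (¬_; Dec; yes; no; contradiction; _×-dec_; _⊎-dec_; _→-dec_)
open import Relation.Nullary.Decidable using (dec-true; dec-false; map′; toSum)
open import Relation.Binary.PropositionalEquality

private
  variable
    A B : Set

remove : {x : A} {ys : List A} → x ∈ ys →
  Σ (List A) λ zs → length ys ≡ suc (length zs) × (∀ {z} → z ∈ ys → z ≢ x → z ∈ zs)
remove x∈ys with ∈-∃++ x∈ys
... | l , r , refl = l ++ r , shorter , keeps
  where
  shorter : length (l ++ _ ∷ r) ≡ suc (length (l ++ r))
  shorter = length-++-sucʳ l _ r
  keeps : ∀ {z} → z ∈ l ++ _ ∷ r → z ≢ _ → z ∈ l ++ r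
  keeps z∈ z≢x with ∈-++⁻ l z∈
  ... | inj₁ z∈l = ∈-++⁺ˡ z∈l
  ... | inj₂ (here z≡x) = ⊥-elim (z≢x z≡x)
  ... | inj₂ (there z∈r) = ∈-++⁺ʳ l z∈r

unique-⊆⇒length≤ : {xs ys : List A} → Unique xs → (∀ {z} → z ∈ xs → z ∈ ys) → length xs ≤ length ys
unique-⊆⇒length≤ {xs = []} _ _ = z≤n
unique-⊆⇒length≤ {xs = x ∷ xs} (x∉xs ∷ u) xs⊆ys with remove (xs⊆ys (here refl))
... | zs , shorter , keeps rewrite shorter =
  s≤s (unique-⊆⇒length≤ u (λ z∈xs → keeps (xs⊆ys (there z∈xs)) (λ { refl → All.lookup x∉xs z∈xs refl })))

InjectiveOn : (A → B) → List A → Set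
InjectiveOn f xs = ∀ {x x'} → x ∈ xs → x' ∈ xs → f x ≡ f x' → x ≡ x'

unique-map : {f : A → B} {xs : List A} → Unique xs → InjectiveOn f xs → Unique (map f xs)
unique-map {xs = []} _ _ = []
unique-map {f = f} {xs = x ∷ xs} (x∉xs ∷ u) inj =
  All.tabulate (λ fz∈ fx≡ → let (z , z∈ , eq) = ∈-map⁻ f fz∈ in
                   All.lookup x∉xs z∈ (inj (here refl) (there z∈) (trans fx≡ eq)))
  ∷ unique-map u (λ p q → inj (there p) (there q))

image⊆ : {xs : List A} {ys : List B} (f : A → B) → (∀ {x} → x ∈ xs → f x ∈ ys) →
  ∀ {y} → y ∈ map f xs → y ∈ ys
image⊆ {xs = xs} f into y∈ with ∈-map⁻ f y∈
... | x , x∈ , refl = into x∈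

injection⇒length≤ : {xs : List A} {ys : List B} (f : A → B) → Unique xs → InjectiveOn f xs →
  (∀ {x} → x ∈ xs → f x ∈ ys) → length xs ≤ length ys
injection⇒length≤ {xs = xs} f u inj into =
  subst (_≤ _) (length-map f xs) (unique-⊆⇒length≤ (unique-map u inj) (image⊆ f into))

injection⇒length< : {xs : List A} {ys : List B} (f : A → B) (y : B) → Unique xs → InjectiveOn f xs →
  (∀ {x} → x ∈ xs → f x ∈ ys) → y ∈ ys → (∀ {x} → x ∈ xs → f x ≢ y) → length xs < length ys
injection⇒length< {xs = xs} f y u inj into y∈ys missed =
  subst (_< _) (length-map f xs) (unique-⊆⇒length≤ (y∉image ∷ unique-map u inj) y∷image⊆ys)
  where
  y∉image : All.All (y ≢_) (map f xs)
  y∉image = All.tabulate λ fx∈ y≡fx → let (x , x∈ , fx≡) = ∈-map⁻ f fx∈ in missed x∈ (sym (trans y≡fx fx≡))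
  y∷image⊆ys : ∀ {z} → z ∈ y ∷ map f xs → z ∈ _
  y∷image⊆ys (here refl) = y∈ys
  y∷image⊆ys (there z∈) = image⊆ f into z∈

∈-filterᵇ⁺ : (p : A → Bool) {x : A} {xs : List A} → x ∈ xs → p x ≡ true → x ∈ filterᵇ p xs
∈-filterᵇ⁺ p x∈ px = ∈-filter⁺ (T? ∘ p) x∈ (Equivalence.from T-≡ px)

∈-filterᵇ⁻ : (p : A → Bool) {x : A} {xs : List A} → x ∈ filterᵇ p xs → x ∈ xs × p x ≡ true
∈-filterᵇ⁻ p x∈ with ∈-filter⁻ (T? ∘ p) x∈
... | x∈xs , px = x∈xs , Equivalence.to T-≡ px

unique-filterᵇ : (p : A → Bool) {xs : List A} → Unique xs → Unique (filterᵇ p xs)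
unique-filterᵇ p = Unique.filter⁺ (T? ∘ p)

∧-true : {x y : Bool} → (x ∧ y) ≡ true → x ≡ true × y ≡ true
∧-true {true} y≡true = refl , y≡true

∨-true : {x y : Bool} → (x ∨ y) ≡ true → x ≡ true ⊎ y ≡ true
∨-true {true} _ = inj₁ refl
∨-true {false} y≡true = inj₂ y≡true

==⇒≡ : ∀ {n} {x y : Fin n} → (x == y) ≡ true → x ≡ y
==⇒≡ {x = x} {y} eq with x ≟ᶠ y
... | yes x≡y = x≡y

≡⇒== : ∀ {n} {x y : Fin n} → x ≡ y → (x == y) ≡ true
≡⇒== {x = x} {y} x≡y with x ≟ᶠ y
... | yes _ = refl
... | no x≢y = ⊥-elim (x≢y x≡y)

≢⇒== : ∀ {n} {x y : Fin n} → x ≢ y → (x == y) ≡ false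
≢⇒== {x = x} {y} x≢y with x ≟ᶠ y
... | yes x≡y = ⊥-elim (x≢y x≡y)
... | no _ = refl

==ℕ⇒≡ : {a b : ℕ} → (a ==ℕ b) ≡ true → a ≡ b
==ℕ⇒≡ {zero} {zero} _ = refl
==ℕ⇒≡ {suc a} {suc b} eq = cong suc (==ℕ⇒≡ eq)

bool-ext : {x y : Bool} → (x ≡ true → y ≡ true) → (y ≡ true → x ≡ true) → x ≡ y
bool-ext {false} {false} _ _ = refl
bool-ext {false} {true} _ y⇒x = y⇒x refl
bool-ext {true} {false} x⇒y _ = sym (x⇒y refl)
bool-ext {true} {true} _ _ = refl

allB⁻ : (p : A → Bool) (xs : List A) → allB p xs ≡ true → ∀ {x} → x ∈ xs → p x ≡ true
allB⁻ p (y ∷ xs) all (here refl) = proj₁ (∧-true all)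
allB⁻ p (y ∷ xs) all (there x∈) = allB⁻ p xs (proj₂ (∧-true {p y} all)) x∈

allB⁺ : (p : A → Bool) (xs : List A) → (∀ {x} → x ∈ xs → p x ≡ true) → allB p xs ≡ true
allB⁺ p [] _ = refl
allB⁺ p (y ∷ xs) all rewrite all (here refl) = allB⁺ p xs (all ∘ there)

∈-allVecs : ∀ m n (c : Vec (Fin m) n) → c ∈ allVecs m n
∈-allVecs m zero [] = here refl
∈-allVecs m (suc n) (i ∷ c) =
  ∈-concatMap⁺ (λ j → map (j ∷_) (allVecs m n))
    (Any.map (λ { refl → ∈-map⁺ (i ∷_) (∈-allVecs m n c) }) (∈-allFin i))

∈-allSubsets : ∀ M (s : Vec Bool M) → s ∈ allSubsets M
∈-allSubsets zero [] = here refl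
∈-allSubsets (suc M) (true ∷ s) = ∈-++⁺ˡ (∈-map⁺ (true ∷_) (∈-allSubsets M s))
∈-allSubsets (suc M) (false ∷ s) =
  ∈-++⁺ʳ (map (true ∷_) (allSubsets M)) (∈-++⁺ˡ (∈-map⁺ (false ∷_) (∈-allSubsets M s)))

allSubsets-unique : ∀ M → Unique (allSubsets M)
allSubsets-unique zero = All.[] ∷ []
allSubsets-unique (suc M) =
  Unique.++⁺ (Unique.map⁺ ∷-injectiveʳ (allSubsets-unique M))
             (Unique.++⁺ (Unique.map⁺ ∷-injectiveʳ (allSubsets-unique M)) [] λ ())
             disjoint
  where
  disjoint : ∀ {s} → s ∈ map (true ∷_) (allSubsets M) × s ∈ map (false ∷_) (allSubsets M) ++ [] → ⊥
  disjoint (s∈true , s∈false) with ∈-map⁻ (true ∷_) s∈true | ∈-++⁻ (map (false ∷_) (allSubsets M)) s∈false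
  ... | _ , _ , refl | inj₁ s∈ with ∈-map⁻ (false ∷_) s∈
  ...   | _ , _ , ()

size≡count : ∀ {M} (s : Vec Bool M) → length (filterᵇ (lookup s) (allFin M)) ≡ size s
size≡count s = count s id (λ _ → refl)
  where
  count : ∀ {M} {X : Set} (s : Vec Bool M) (f : Fin M → X) {p : X → Bool} →
    (∀ i → p (f i) ≡ lookup s i) → length (filterᵇ p (List.tabulate f)) ≡ size s
  count [] f _ = refl
  count (true ∷ s) f pf rewrite pf zero = cong suc (count s (f ∘ suc) (pf ∘ suc))
  count (false ∷ s) f pf rewrite pf zero = count s (f ∘ suc) (pf ∘ suc)

length-allFin : ∀ n → length (allFin n) ≡ n
length-allFin n = length-tabulate id

isProper⁺ : ∀ {n m} (G : Graph n) (c : Fin n → Fin m) →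
  (∀ u v → adj G u v ≡ true → c u ≢ c v) → isProper G (Vec.tabulate c) ≡ true
isProper⁺ {n} G c proper = allB⁺ _ (allFin n) λ {u} _ → allB⁺ _ (allFin n) λ {v} _ → edge u v
  where
  edge : ∀ u v → (not (adj G u v) ∨ not (lookup (Vec.tabulate c) u == lookup (Vec.tabulate c) v)) ≡ true
  edge u v rewrite lookup∘tabulate c u | lookup∘tabulate c v with adj G u v in uv
  ... | false = refl
  ... | true rewrite ≢⇒== (proper u v uv) = refl

isIndependent⁻ : ∀ {M} (H : Graph M) (s : Vec Bool M) → isIndependent H s ≡ true →
  ∀ x y → lookup s x ≡ true → lookup s y ≡ true → adj H x y ≡ false
isIndependent⁻ {M} H s indep x y sx sy with adj H x y in xy
... | false = refl
... | true = ⊥-elim (absurd (allB⁻ _ (allFin M) (allB⁻ _ (allFin M) indep (∈-allFin x)) (∈-allFin y)))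
  where
  absurd : not (lookup s x ∧ lookup s y ∧ adj H x y) ≡ true → ⊥
  absurd no-edge rewrite sx | sy | xy with no-edge
  ... | ()

-- Given, for each ordered
-- pair (u,v), a permutation τ u v of the colours with τ v u inverse to τ u v,
-- the cover has L(u) = {u} × colours, with (u,i) ~ (v,j) for uv ∈ E(G) iff
-- j = τ u v i.  Its colourings are exactly the maps d with d v ≠ τ u v (d u)
-- on every edge; this module reduces "P_DP(G,m) < P(G,m)" to exhibiting an
-- injection from such maps into proper colourings that misses one colouring.
-- (There are m = m₀ + 1 colours, so that decoding has a default colour.)
module PermutationCover {N m₀ : ℕ} (G : Graph N)
  (τ : Fin N → Fin N → Fin (suc m₀) → Fin (suc m₀))
  (τ-inverse : ∀ u v i → τ v u (τ u v i) ≡ i) where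

  m : ℕ
  m = suc m₀

  NM : ℕ
  NM = N * m

  vertex : Fin N → Fin m → Fin NM
  vertex = combine

  owner : Fin NM → Fin N
  owner x = proj₁ (remQuot {N} m x)

  colour : Fin NM → Fin m
  colour x = proj₂ (remQuot {N} m x)

  owner-vertex : ∀ u i → owner (vertex u i) ≡ u
  owner-vertex u i = cong proj₁ (remQuot-combine u i)

  colour-vertex : ∀ u i → colour (vertex u i) ≡ i
  colour-vertex u i = cong proj₂ (remQuot-combine u i)

  vertex-≡ : ∀ {x y} → owner x ≡ owner y → colour x ≡ colour y → x ≡ y
  vertex-≡ {x} {y} o≡ c≡ =
    trans (sym (combine-remQuot {N} m x)) (trans (cong₂ vertex o≡ c≡) (combine-remQuot {N} m y))

  -- τ u v i = j  iff  τ v u j = i, which makes the adjacency of H symmetric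
  τ-flip : ∀ u v {i j} → j ≡ τ u v i → i ≡ τ v u j
  τ-flip u v {i} refl = sym (τ-inverse u v i)

  adjH : Fin NM → Fin NM → Bool
  adjH x y = (owner x == owner y ∧ not (colour x == colour y))
           ∨ (adj G (owner x) (owner y) ∧ (colour y == τ (owner x) (owner y) (colour x)))

  adjH-sym : ∀ x y → adjH x y ≡ adjH y x
  adjH-sym x y = cong₂ _∨_ (cong₂ _∧_ (==-sym (owner x) (owner y)) (cong not (==-sym (colour x) (colour y))))
                           (cong₂ _∧_ (Graph.sym G (owner x) (owner y)) matched)
    where
    ==-sym : ∀ {n} (i j : Fin n) → (i == j) ≡ (j == i)
    ==-sym i j = bool-ext (≡⇒== ∘ sym ∘ ==⇒≡) (≡⇒== ∘ sym ∘ ==⇒≡)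
    matched : (colour y == τ (owner x) (owner y) (colour x)) ≡ (colour x == τ (owner y) (owner x) (colour y))
    matched = bool-ext (≡⇒== ∘ τ-flip (owner x) (owner y) ∘ ==⇒≡) (≡⇒== ∘ τ-flip (owner y) (owner x) ∘ ==⇒≡)

  adjH-irrefl : ∀ x → adjH x x ≡ false
  adjH-irrefl x rewrite ≡⇒== (refl {x = owner x}) | ≡⇒== (refl {x = colour x}) | irrefl G (owner x) = refl

  coverGraph : Graph NM
  coverGraph = record { adj = adjH ; sym = adjH-sym ; irrefl = adjH-irrefl }

  adjH-colour : ∀ x y → adjH x y ≡ true → owner x ≢ owner y → colour y ≡ τ (owner x) (owner y) (colour x)
  adjH-colour x y xy o≢ rewrite ≢⇒== o≢ = ==⇒≡ (proj₂ (∧-true {adj G (owner x) (owner y)} xy))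

  lists-are-cliques : ∀ x y → x ≢ y → owner x ≡ owner y → adjH x y ≡ true
  lists-are-cliques x y x≢y o≡ rewrite o≡ | ≡⇒== (refl {x = owner y}) | ≢⇒== (x≢y ∘ vertex-≡ o≡) = refl

  edges-follow-G : ∀ x y → adjH x y ≡ true → owner x ≡ owner y ⊎ adj G (owner x) (owner y) ≡ true
  edges-follow-G x y xy with ∨-true {owner x == owner y ∧ not (colour x == colour y)} xy
  ... | inj₁ same = inj₁ (==⇒≡ (proj₁ (∧-true same)))
  ... | inj₂ edge = inj₂ (proj₁ (∧-true edge))

  edges-are-matchings : ∀ x y z → adjH x y ≡ true → adjH x z ≡ true →
                        owner x ≢ owner y → owner y ≡ owner z → y ≡ z
  edges-are-matchings x y z xy xz ox≢oy oy≡oz = vertex-≡ oy≡oz (begin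
    colour y                             ≡⟨ adjH-colour x y xy ox≢oy ⟩
    τ (owner x) (owner y) (colour x)     ≡⟨ cong (λ w → τ (owner x) w (colour x)) oy≡oz ⟩
    τ (owner x) (owner z) (colour x)     ≡⟨ adjH-colour x z xz (ox≢oy ∘ flip trans (sym oy≡oz)) ⟨
    colour z                             ∎)
    where open ≡-Reasoning

  -- L(u) has m elements: colour is injective on it and vertex u maps the colours into it.
  lists-have-m-elements : ∀ u → length (filterᵇ (λ x → owner x == u) (allFin NM)) ≡ m
  lists-have-m-elements u = ≤-antisym
    (subst (length L ≤_) (length-allFin m)
      (injection⇒length≤ {xs = L} {ys = allFin m} colour (unique-filterᵇ inL (Unique.allFin⁺ NM))
        (λ x∈ x'∈ c≡ → vertex-≡ (trans (owned x∈) (sym (owned x'∈))) c≡) (λ {x} _ → ∈-allFin (colour x))))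
    (subst (_≤ length L) (length-allFin m)
      (injection⇒length≤ {xs = allFin m} {ys = L} (vertex u) (Unique.allFin⁺ m)
        (λ {i} {j} _ _ → combine-injectiveʳ u i u j)
        (λ {i} _ → ∈-filterᵇ⁺ inL (∈-allFin (vertex u i)) (≡⇒== (owner-vertex u i)))))
    where
    inL : Fin NM → Bool
    inL x = owner x == u
    L : List (Fin NM)
    L = filterᵇ inL (allFin NM)
    owned : ∀ {x} → x ∈ L → owner x ≡ u
    owned x∈ = ==⇒≡ (proj₂ (∈-filterᵇ⁻ inL {xs = allFin NM} x∈))

  cover : Cover G m
  cover = record { M = NM ; H = coverGraph ; own = owner
                 ; clique = lists-are-cliques ; edgeOK = edges-follow-G
                 ; matching = edges-are-matchings ; mfold = lists-have-m-elements }

  CoverColouring : (Fin N → Fin m) → Set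
  CoverColouring d = ∀ u v → adj G u v ≡ true → d v ≢ τ u v (d u)

  Chosen : Vec Bool NM → Set
  Chosen s = (isIndependent coverGraph s ∧ (size s ==ℕ N)) ≡ true

  module _ (s : Vec Bool NM) (chosen : Chosen s) where

    independent : ∀ x y → lookup s x ≡ true → lookup s y ≡ true → adjH x y ≡ false
    independent = isIndependent⁻ coverGraph s (proj₁ (∧-true chosen))

    -- Since each L(u) is a clique, s meets each L(u) at most once ...
    at-most-one : ∀ {x y} → lookup s x ≡ true → lookup s y ≡ true → owner x ≡ owner y → x ≡ y
    at-most-one {x} {y} sx sy o≡ with x ≟ᶠ y
    ... | yes x≡y = x≡y
    ... | no x≢y with trans (sym (lists-are-cliques x y x≢y o≡)) (independent x y sx sy)
    ...   | ()

    -- ... and as |s| = N, it meets every L(u): otherwise owner would inject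
    -- s into V(G) ∖ {u}.
    meets-every : ∀ u → (∀ i → lookup s (vertex u i) ≢ true) → ⊥
    meets-every u missing = <-irrefl (==ℕ⇒≡ (proj₂ (∧-true {isIndependent coverGraph s} chosen))) size<N
      where
      S : List (Fin NM)
      S = filterᵇ (lookup s) (allFin NM)
      in-s : ∀ {x} → x ∈ S → lookup s x ≡ true
      in-s x∈ = proj₂ (∈-filterᵇ⁻ (lookup s) {xs = allFin NM} x∈)
      size<N : size s < N
      size<N = subst₂ _<_ (size≡count s) (length-allFin N)
        (injection⇒length< {xs = S} {ys = allFin N} owner u (unique-filterᵇ (lookup s) (Unique.allFin⁺ NM))
          (λ x∈ x'∈ → at-most-one (in-s x∈) (in-s x'∈)) (λ {x} _ → ∈-allFin (owner x)) (∈-allFin u)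
          (λ {x} x∈ ox≡u → missing (colour x) (subst (λ w → lookup s w ≡ true)
             (sym (trans (cong (λ w → vertex w (colour x)) (sym ox≡u)) (combine-remQuot {N} m x)))
             (in-s x∈))))

  search : (s : Vec Bool NM) (u : Fin N) → Dec (∃ λ i → lookup s (vertex u i) ≡ true)
  search s u = any? (λ i → lookup s (vertex u i) Bool.≟ true)

  decode : Vec Bool NM → Fin N → Fin m
  decode s u with search s u
  ... | yes (i , _) = i
  ... | no _ = zero

  decode-chosen : ∀ s → Chosen s → ∀ u → lookup s (vertex u (decode s u)) ≡ true
  decode-chosen s chosen u with search s u
  ... | yes (_ , si) = si
  ... | no none = ⊥-elim (meets-every s chosen u (λ i si → none (i , si)))

  decode-complete : ∀ s → Chosen s → ∀ x → lookup s x ≡ true → x ≡ vertex (owner x) (decode s (owner x))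
  decode-complete s chosen x sx =
    at-most-one s chosen sx (decode-chosen s chosen (owner x)) (sym (owner-vertex (owner x) _))

  decode-colouring : ∀ s → Chosen s → CoverColouring (decode s)
  decode-colouring s chosen u v uv dv≡ =
    edge-absent (independent s chosen x y (decode-chosen s chosen u) (decode-chosen s chosen v))
    where
    x = vertex u (decode s u)
    y = vertex v (decode s v)
    edge : adjH x y ≡ true
    edge rewrite owner-vertex u (decode s u) | owner-vertex v (decode s v)
               | colour-vertex u (decode s u) | colour-vertex v (decode s v)
               | uv | ≡⇒== dv≡ = ∨-zeroʳ _
    edge-absent : adjH x y ≡ false → ⊥
    edge-absent no-edge with trans (sym edge) no-edge
    ... | ()

  decode-injective : ∀ s s' → Chosen s → Chosen s' → decode s ≗ decode s' → s ≡ s'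
  decode-injective s s' chosen chosen' same = begin
    s                          ≡⟨ tabulate∘lookup s ⟨
    Vec.tabulate (lookup s)    ≡⟨ tabulate-cong (λ x → bool-ext (into s s' chosen chosen' same)
                                                            (into s' s chosen' chosen (sym ∘ same))) ⟩
    Vec.tabulate (lookup s')   ≡⟨ tabulate∘lookup s' ⟩
    s'                         ∎
    where
    open ≡-Reasoning
    into : ∀ s s' → Chosen s → Chosen s' → decode s ≗ decode s' →
           ∀ {x} → lookup s x ≡ true → lookup s' x ≡ true
    into s s' cs cs' same' {x} sx = subst (λ w → lookup s' w ≡ true)
      (sym (trans (decode-complete s cs x sx) (cong (vertex (owner x)) (same' (owner x)))))
      (decode-chosen s' cs' (owner x))

  Proper : (Fin N → Fin m) → Set
  Proper c = ∀ u v → adj G u v ≡ true → c u ≢ c v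

  fewer-cover-colourings : (Φ : (Fin N → Fin m) → Fin N → Fin m) →
    (∀ d → CoverColouring d → Proper (Φ d)) →
    (∀ d d' → CoverColouring d → CoverColouring d' → Φ d ≗ Φ d' → d ≗ d') →
    (c : Fin N → Fin m) → Proper c → (∀ d → CoverColouring d → ¬ (Φ d ≗ c)) →
    PDP-lt G m (P G m)
  fewer-cover-colourings Φ proper injective c c-proper missed =
    cover , injection⇒length< F (Vec.tabulate c) (unique-filterᵇ isChosen (allSubsets-unique NM))
      (λ {s} {s'} s∈ s'∈ Fs≡Fs' → decode-injective s s' (chosen s∈) (chosen s'∈)
         (injective _ _ (decode-colouring s (chosen s∈)) (decode-colouring s' (chosen s'∈))
                    (tabulate-injective Fs≡Fs')))
      (λ {s} s∈ → colouring (Φ (decode s)) (proper _ (decode-colouring s (chosen s∈))))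
      (colouring c c-proper)
      (λ {s} s∈ Fs≡c → missed _ (decode-colouring s (chosen s∈)) (tabulate-injective Fs≡c))
    where
    isChosen : Vec Bool NM → Bool
    isChosen s = isIndependent coverGraph s ∧ (size s ==ℕ N)
    chosen : ∀ {s} → s ∈ filterᵇ isChosen (allSubsets NM) → Chosen s
    chosen s∈ = proj₂ (∈-filterᵇ⁻ isChosen {xs = allSubsets NM} s∈)
    F : Vec Bool NM → Vec (Fin m) N
    F s = Vec.tabulate (Φ (decode s))
    colouring : ∀ c → Proper c → Vec.tabulate c ∈ filterᵇ (isProper G) (allVecs m N)
    colouring c c-proper = ∈-filterᵇ⁺ (isProper G) (∈-allVecs m N _) (isProper⁺ G c c-proper)
    tabulate-injective : ∀ {f g : Fin N → Fin m} → Vec.tabulate f ≡ Vec.tabulate g → f ≗ g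
    tabulate-injective {f} {g} eq u =
      trans (sym (lookup∘tabulate f u)) (trans (cong (λ w → lookup w u) eq) (lookup∘tabulate g u))

-- The colours 0 and 1 of Fin (2 + m') ("low" colours) and the transposition σ
-- exchanging them: the permutation placed on the one twisted edge of the cover.
module LowColours {m' : ℕ} where

  Colour : Set
  Colour = Fin (suc (suc m'))

  data Low : Colour → Set where
    low₀ : Low zero
    low₁ : Low (suc zero)

  low? : (c : Colour) → Dec (Low c)
  low? zero = yes low₀
  low? (suc zero) = yes low₁
  low? (suc (suc c)) = no λ ()

  σ : Colour → Colour
  σ zero = suc zero
  σ (suc zero) = zero
  σ (suc (suc c)) = suc (suc c)

  σ-involutive : ∀ c → σ (σ c) ≡ c
  σ-involutive zero = refl
  σ-involutive (suc zero) = refl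
  σ-involutive (suc (suc c)) = refl

  σ-injective : ∀ {c c'} → σ c ≡ σ c' → c ≡ c'
  σ-injective {c} {c'} eq = trans (sym (σ-involutive c)) (trans (cong σ eq) (σ-involutive c'))

  σ-Low : ∀ {c} → Low c → Low (σ c)
  σ-Low low₀ = low₁
  σ-Low low₁ = low₀

  σ-Low⁻ : ∀ {c} → Low (σ c) → Low c
  σ-Low⁻ {c} low = subst Low (σ-involutive c) (σ-Low low)

  σ-fixes-high : ∀ {c} → ¬ Low c → σ c ≡ c
  σ-fixes-high {zero} high = contradiction low₀ high
  σ-fixes-high {suc zero} high = contradiction low₁ high
  σ-fixes-high {suc (suc c)} _ = refl

  σ-moves-low : ∀ {c} → Low c → σ c ≢ c
  σ-moves-low low₀ ()
  σ-moves-low low₁ ()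

  low-pair : ∀ {c c'} → Low c → Low c' → c' ≡ c ⊎ c' ≡ σ c
  low-pair low₀ low₀ = inj₁ refl
  low-pair low₀ low₁ = inj₂ refl
  low-pair low₁ low₀ = inj₂ refl
  low-pair low₁ low₁ = inj₁ refl

  alternate : Colour → ℕ → Colour
  alternate c t = fold c σ t

  alternate-even : ∀ c j → alternate c (j + j) ≡ c
  alternate-even c zero = refl
  alternate-even c (suc j) rewrite +-suc j j = trans (σ-involutive _) (alternate-even c j)

  alternate-Low : ∀ {c} → Low c → ∀ t → Low (alternate c t)
  alternate-Low low zero = low
  alternate-Low low (suc t) = σ-Low (alternate-Low low t)

  normalise : (x y : Colour) → x ≢ y →
    Σ (Colour → Colour) λ π → (∀ {c c'} → π c ≡ π c' → c ≡ c') × π x ≡ zero × π y ≡ suc zero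
  normalise x y x≢y = π , π-injective , π-x , π-y
    where
    y' : Colour
    y' = transpose x zero y
    π : Colour → Colour
    π = transpose y' (suc zero) ∘ transpose x zero
    transpose-injective : ∀ (i j : Colour) {c c'} → transpose i j c ≡ transpose i j c' → c ≡ c'
    transpose-injective i j {c} {c'} eq =
      trans (sym (transpose-inverse j i)) (trans (cong (transpose j i) eq) (transpose-inverse j i))
    transpose-hit : ∀ (i j : Colour) → transpose i j i ≡ j
    transpose-hit i j rewrite dec-true (i ≟ᶠ i) refl = refl
    transpose-miss : ∀ (i j c : Colour) → c ≢ i → c ≢ j → transpose i j c ≡ c
    transpose-miss i j c c≢i c≢j rewrite dec-false (c ≟ᶠ i) c≢i | dec-false (c ≟ᶠ j) c≢j = refl
    y'≢0 : y' ≢ zero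
    y'≢0 y'≡0 = x≢y (transpose-injective x zero (trans (transpose-hit x zero) (sym y'≡0)))
    π-injective : ∀ {c c'} → π c ≡ π c' → c ≡ c'
    π-injective = transpose-injective x zero ∘ transpose-injective y' (suc zero)
    π-x : π x ≡ zero
    π-x rewrite transpose-hit x zero = transpose-miss y' (suc zero) zero (y'≢0 ∘ sym) λ ()
    π-y : π y ≡ suc zero
    π-y = transpose-hit y' (suc zero)

earLength : ℕ → ℕ
earLength j = suc (suc (suc (suc (j + j))))

record EvenEar {N : ℕ} (G : Graph N) (j : ℕ) : Set where
  field
    walk     : ℕ → Fin N
    closed   : walk (earLength j) ≡ walk 0
    distinct : ∀ {s t} → s < earLength j → t < earLength j → walk s ≡ walk t → s ≡ t
    step     : ∀ {t} → t < earLength j → adj G (walk t) (walk (suc t)) ≡ true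
    internal-neighbours : ∀ {t v} → 2 ≤ t → t < earLength j → adj G (walk t) v ≡ true →
                          v ≡ walk (pred t) ⊎ v ≡ walk (suc t)

  Internal : Fin N → Set
  Internal v = ∃ λ t → t < earLength j × 2 ≤ t × walk t ≡ v

-- Twist the canonical cover on the edge b ψ₂ (a = ψ 0,
-- b = ψ 1) by σ.  For a cover colouring d with d b low, recolour by σ the
-- longest run ψ 2, ψ 3, … of internal vertices carrying low colours: the
-- result is a proper colouring, because the walk is even and its internal
-- vertices only see their walk neighbours; recolouring is an involution that
-- only looks at which colours are low, hence injective.  The proper colouring
-- "base" (ψ t ↦ σᵗ 1 on the walk, a renamed colouring f of the rest) is missed,
-- as its preimage would give ψ (n-1) and a the same colour.
module EarArgument {N j m' : ℕ} {G : Graph N} (E : EvenEar G j)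
  (f : Fin N → Fin (suc (suc m')))
  (f-proper : ∀ u v → adj G u v ≡ true → ¬ EvenEar.Internal E u → ¬ EvenEar.Internal E v → f u ≢ f v) where

  open EvenEar E
  open LowColours {m'}

  n : ℕ
  n = earLength j

  ψ : ℕ → Fin N
  ψ = walk

  a b : Fin N
  a = ψ 0
  b = ψ 1

  adj-sym : ∀ {u v} → adj G u v ≡ true → adj G v u ≡ true
  adj-sym {u} {v} uv = trans (Graph.sym G v u) uv

  internal? : ∀ v → Dec (Internal v)
  internal? v = anyUpTo? (λ t → 2 ≤? t ×-dec ψ t ≟ᶠ v) n

  internal-at : ∀ {t} → 2 ≤ t → t < n → Internal (ψ t)
  internal-at {t} 2≤t t<n = t , t<n , 2≤t , refl

  position : ∀ {t} → (i : Internal (ψ t)) → t < n → proj₁ i ≡ t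
  position (s , s<n , _ , ψs≡ψt) t<n = distinct s<n t<n ψs≡ψt

  a≢b : a ≢ b
  a≢b a≡b with distinct (s≤s z≤n) (s≤s (s≤s z≤n)) a≡b
  ... | ()

  a-external : ¬ Internal a
  a-external (s , s<n , 2≤s , ψs≡a) with distinct s<n (s≤s z≤n) ψs≡a
  ... | refl with 2≤s
  ...   | ()

  b-external : ¬ Internal b
  b-external (s , s<n , 2≤s , ψs≡b) with distinct s<n (s≤s (s≤s z≤n)) ψs≡b
  ... | refl with 2≤s
  ...   | s≤s ()

  internal≢b : ∀ {v} → Internal v → v ≢ b
  internal≢b i refl = b-external i

  Twisted : Fin N → Fin N → Set
  Twisted u v = (u ≡ b × v ≡ ψ 2) ⊎ (u ≡ ψ 2 × v ≡ b)

  twisted? : ∀ u v → Dec (Twisted u v)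
  twisted? u v = (u ≟ᶠ b ×-dec v ≟ᶠ ψ 2) ⊎-dec (u ≟ᶠ ψ 2 ×-dec v ≟ᶠ b)

  twisted-sym : ∀ {u v} → Twisted u v → Twisted v u
  twisted-sym (inj₁ (u≡b , v≡ψ₂)) = inj₂ (v≡ψ₂ , u≡b)
  twisted-sym (inj₂ (u≡ψ₂ , v≡b)) = inj₁ (v≡b , u≡ψ₂)

  untwisted : ∀ {u v} → u ≢ b → v ≢ b → ¬ Twisted u v
  untwisted u≢b _ (inj₁ (u≡b , _)) = u≢b u≡b
  untwisted _ v≢b (inj₂ (_ , v≡b)) = v≢b v≡b

  ab-untwisted : ¬ Twisted a b
  ab-untwisted (inj₁ (a≡b , _)) = a≢b a≡b
  ab-untwisted (inj₂ (a≡ψ₂ , _)) = a-external (2 , s≤s (s≤s (s≤s z≤n)) , ≤-refl , sym a≡ψ₂)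

  τ : Fin N → Fin N → Colour → Colour
  τ u v c with twisted? u v
  ... | yes _ = σ c
  ... | no _ = c

  τ-twisted : ∀ {u v} → Twisted u v → ∀ c → τ u v c ≡ σ c
  τ-twisted {u} {v} tw c with twisted? u v
  ... | yes _ = refl
  ... | no ¬tw = contradiction tw ¬tw

  τ-plain : ∀ {u v} → ¬ Twisted u v → ∀ c → τ u v c ≡ c
  τ-plain {u} {v} ¬tw c with twisted? u v
  ... | yes tw = contradiction tw ¬tw
  ... | no _ = refl

  τ-inverse : ∀ u v c → τ v u (τ u v c) ≡ c
  τ-inverse u v c with twisted? u v
  ... | yes tw = trans (τ-twisted (twisted-sym tw) (σ c)) (σ-involutive c)
  ... | no ¬tw = τ-plain (¬tw ∘ twisted-sym) c

  open PermutationCover G τ τ-inverse using (CoverColouring; Proper; fewer-cover-colourings)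

  module _ {d : Fin N → Colour} (colouring : CoverColouring d) where

    twisted-edge : d (ψ 2) ≢ σ (d b)
    twisted-edge eq =
      colouring b (ψ 2) (step (s≤s (s≤s z≤n))) (trans eq (sym (τ-twisted (inj₁ (refl , refl)) (d b))))

    plain-edge : ∀ {u v} → adj G u v ≡ true → ¬ Twisted u v → d u ≢ d v
    plain-edge {u} {v} uv ¬tw du≡dv = colouring u v uv (trans (sym du≡dv) (sym (τ-plain ¬tw (d u))))

  record Prefix (d : Fin N → Colour) (t : ℕ) : Set where
    constructor prefix
    field low-on : ∀ {s} → 1 ≤ s → s ≤ t → Low (d (ψ s))
  open Prefix

  prefix? : ∀ d t → Dec (Prefix d t)
  prefix? d t = map′ (λ low → prefix λ {s} 1≤s s≤t → low (s≤s s≤t) 1≤s)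
                     (λ low {s} s<1+t 1≤s → low-on low 1≤s (≤-pred s<1+t))
                     (allUpTo? (λ s → (1 ≤? s) →-dec low? (d (ψ s))) (suc t))

  prefix-last : ∀ {d t} → 1 ≤ t → Prefix d t → Low (d (ψ t))
  prefix-last 1≤t low = low-on low 1≤t ≤-refl

  prefix-b : ∀ {d t} → 1 ≤ t → Prefix d t → Low (d b)
  prefix-b 1≤t low = low-on low (s≤s z≤n) 1≤t

  prefix-shorten : ∀ {d t} → Prefix d (suc t) → Prefix d t
  prefix-shorten low = prefix λ 1≤s s≤t → low-on low 1≤s (≤-trans s≤t (n≤1+n _))

  prefix-extend : ∀ {d t} → Prefix d t → Low (d (ψ (suc t))) → Prefix d (suc t)
  prefix-extend {d} {t} low last = prefix extended
    where
    extended : ∀ {s} → 1 ≤ s → s ≤ suc t → Low (d (ψ s))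
    extended 1≤s s≤1+t with m≤n⇒m<n∨m≡n s≤1+t
    ... | inj₁ s<1+t = low-on low 1≤s (≤-pred s<1+t)
    ... | inj₂ refl = last

  prefix-1 : ∀ {d} → Low (d b) → Prefix d 1
  prefix-1 low = prefix λ { (s≤s z≤n) (s≤s z≤n) → low }

  prefix-transfer : ∀ {d d'} → (∀ v → Low (d v) → Low (d' v)) → ∀ {t} → Prefix d t → Prefix d' t
  prefix-transfer low⇒low low = prefix λ 1≤s s≤t → low⇒low _ (low-on low 1≤s s≤t)

  Region : (Fin N → Colour) → Fin N → Set
  Region d v = Σ (Internal v) λ i → Prefix d (proj₁ i)

  region-at : ∀ {d t} → 2 ≤ t → t < n → Prefix d t → Region d (ψ t)
  region-at 2≤t t<n low = internal-at 2≤t t<n , low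

  region-prefix : ∀ {d t} → t < n → Region d (ψ t) → Prefix d t
  region-prefix {d} t<n (i , low) = subst (Prefix d) (position i t<n) low

  region-transfer : ∀ {d d'} → (∀ v → Low (d v) → Low (d' v)) → ∀ {v} → Region d v → Region d' v
  region-transfer low⇒low (i , low) = i , prefix-transfer low⇒low low

  -- the region is decidable (the position of an internal vertex is unique)
  region? : ∀ d v → Dec (Region d v)
  region? d v with internal? v
  ... | no external = no (external ∘ proj₁)
  ... | yes i@(t , t<n , _ , refl) = map′ (i ,_) (region-prefix t<n) (prefix? d t)

  recolour : (Fin N → Colour) → Fin N → Colour
  recolour d v with region? d v
  ... | yes _ = σ (d v)
  ... | no _ = d v

  recolour-in : ∀ {d v} → Region d v → recolour d v ≡ σ (d v)
  recolour-in {d} {v} r with region? d v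
  ... | yes _ = refl
  ... | no ¬r = contradiction r ¬r

  recolour-out : ∀ {d v} → ¬ Region d v → recolour d v ≡ d v
  recolour-out {d} {v} ¬r with region? d v
  ... | yes r = contradiction r ¬r
  ... | no _ = refl

  recolour-Low : ∀ d v → Low (d v) → Low (recolour d v)
  recolour-Low d v low with region? d v
  ... | yes _ = σ-Low low
  ... | no _ = low

  recolour-Low⁻ : ∀ d v → Low (recolour d v) → Low (d v)
  recolour-Low⁻ d v low with region? d v
  ... | yes _ = σ-Low⁻ low
  ... | no _ = low

  recolour-involutive : ∀ d v → recolour (recolour d) v ≡ d v
  recolour-involutive d v with toSum (region? d v)
  ... | inj₁ r = begin
    recolour (recolour d) v   ≡⟨ recolour-in (region-transfer (recolour-Low d) r) ⟩
    σ (recolour d v)          ≡⟨ cong σ (recolour-in r) ⟩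
    σ (σ (d v))               ≡⟨ σ-involutive (d v) ⟩
    d v                       ∎
    where open ≡-Reasoning
  ... | inj₂ ¬r = trans (recolour-out (¬r ∘ region-transfer (recolour-Low⁻ d))) (recolour-out ¬r)

  recolour-cong : ∀ {d d'} → d ≗ d' → ∀ v → recolour d v ≡ recolour d' v
  recolour-cong {d} {d'} d≗d' v with toSum (region? d v)
  ... | inj₁ r = trans (recolour-in r) (trans (cong σ (d≗d' v))
                   (sym (recolour-in (region-transfer (λ u → subst Low (d≗d' u)) r))))
  ... | inj₂ ¬r = trans (recolour-out ¬r) (trans (d≗d' v)
                   (sym (recolour-out (¬r ∘ region-transfer (λ u → subst Low (sym (d≗d' u)))))))

  recolour-injective : ∀ {d d'} → recolour d ≗ recolour d' → d ≗ d'
  recolour-injective {d} {d'} same v = begin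
    d v                        ≡⟨ recolour-involutive d v ⟨
    recolour (recolour d) v    ≡⟨ recolour-cong same v ⟩
    recolour (recolour d') v   ≡⟨ recolour-involutive d' v ⟩
    d' v                       ∎
    where open ≡-Reasoning

  module _ {d : Fin N → Colour} (colouring : CoverColouring d) where

    -- Along a low prefix a cover colouring alternates, starting from d b on ψ 2
    -- (σ on the twisted edge makes ψ 2 repeat the colour of b).
    alternation : ∀ s → 2 + s < n → Prefix d (2 + s) → d (ψ (2 + s)) ≡ alternate (d b) s
    alternation zero _ low with low-pair (prefix-b (s≤s z≤n) low) (prefix-last (s≤s z≤n) low)
    ... | inj₁ same = same
    ... | inj₂ flipped = contradiction flipped (twisted-edge colouring)
    alternation (suc s) 3+s<n low
      with low-pair (prefix-last (s≤s z≤n) (prefix-shorten low)) (prefix-last (s≤s z≤n) low)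
    ... | inj₁ same = contradiction (sym same)
          (plain-edge colouring (step 2+s<n)
            (untwisted (internal≢b (internal-at 2≤2+s 2+s<n))
                       (internal≢b (internal-at (≤-trans 2≤2+s (n≤1+n _)) 3+s<n))))
      where
      2≤2+s : 2 ≤ 2 + s
      2≤2+s = s≤s (s≤s z≤n)
      2+s<n : 2 + s < n
      2+s<n = ≤-trans (n≤1+n _) 3+s<n
    ... | inj₂ flipped = trans flipped (cong σ (alternation s (≤-trans (n≤1+n _) 3+s<n) (prefix-shorten low)))

    -- An edge leaving the region from ψ t goes back to b (t = 2), forward to a
    -- vertex without a low colour, or forward to a (t = n - 1, where alternation
    -- gives ψ t the colour σ (d b)); in each case recolouring ψ t keeps it proper.
    leaving-backwards : ∀ {t} → 2 ≤ t → t < n → Prefix d t → ¬ Region d (ψ (pred t)) →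
                        σ (d (ψ t)) ≢ d (ψ (pred t))
    leaving-backwards {suc (suc zero)} (s≤s (s≤s z≤n)) _ _ _ eq =
      twisted-edge colouring (trans (sym (σ-involutive _)) (cong σ eq))
    leaving-backwards {suc (suc (suc t))} _ t<n low ¬r =
      contradiction (region-at (s≤s (s≤s z≤n)) (≤-trans (n≤1+n _) t<n) (prefix-shorten low)) ¬r

    leaving-forwards : ∀ {t} → 2 ≤ t → t < n → Prefix d t → ¬ Region d (ψ (suc t)) →
                       σ (d (ψ t)) ≢ d (ψ (suc t))
    leaving-forwards {t} 2≤t t<n low ¬r with m≤n⇒m<n∨m≡n t<n
    ... | inj₁ 1+t<n with low? (d (ψ (suc t)))
    ...   | yes next = contradiction (region-at (≤-trans 2≤t (n≤1+n _)) 1+t<n (prefix-extend low next)) ¬r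
    ...   | no high = λ eq → high (subst Low eq (σ-Low (prefix-last (≤-trans (s≤s z≤n) 2≤t) low)))
    leaving-forwards {t} 2≤t t<n low ¬r | inj₂ refl =
      λ eq → plain-edge colouring (step (s≤s z≤n)) ab-untwisted (begin
      d a                               ≡⟨ cong d closed ⟨
      d (ψ n)                           ≡⟨ eq ⟨
      σ (d (ψ t))                       ≡⟨ cong σ (alternation (suc (j + j)) t<n low) ⟩
      σ (σ (alternate (d b) (j + j)))   ≡⟨ σ-involutive _ ⟩
      alternate (d b) (j + j)           ≡⟨ alternate-even (d b) j ⟩
      d b                               ∎)
      where open ≡-Reasoning

    leaving-region : ∀ {u v} → Region d u → ¬ Region d v → adj G u v ≡ true → σ (d u) ≢ d v
    leaving-region ((t , t<n , 2≤t , refl) , low) ¬rv uv with internal-neighbours 2≤t t<n uv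
    ... | inj₁ refl = leaving-backwards 2≤t t<n low ¬rv
    ... | inj₂ refl = leaving-forwards 2≤t t<n low ¬rv

    -- If ψ 2 is not recoloured, the twisted edge b ψ₂ is already proper:
    -- either d b is low and d (ψ 2) is not, or σ fixes d b.
    twisted-edge-outside : ¬ Region d (ψ 2) → d b ≢ d (ψ 2)
    twisted-edge-outside ¬r with low? (d b)
    ... | yes low =
      λ eq → ¬r (region-at ≤-refl (s≤s (s≤s (s≤s z≤n))) (prefix-extend (prefix-1 low) (subst Low eq low)))
    ... | no high = λ eq → twisted-edge colouring (trans (sym eq) (sym (σ-fixes-high high)))

    outside-region : ∀ {u v} → ¬ Region d u → ¬ Region d v → adj G u v ≡ true → d u ≢ d v
    outside-region {u} {v} ¬ru ¬rv uv with twisted? u v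
    ... | no ¬tw = plain-edge colouring uv ¬tw
    ... | yes (inj₁ (refl , refl)) = twisted-edge-outside ¬rv
    ... | yes (inj₂ (refl , refl)) = twisted-edge-outside ¬ru ∘ sym

    recolour-proper : Proper (recolour d)
    recolour-proper u v uv with toSum (region? d u) | toSum (region? d v)
    ... | inj₁ ru | inj₁ rv rewrite recolour-in ru | recolour-in rv =
      plain-edge colouring uv (untwisted (internal≢b (proj₁ ru)) (internal≢b (proj₁ rv))) ∘ σ-injective
    ... | inj₁ ru | inj₂ ¬rv rewrite recolour-in ru | recolour-out ¬rv = leaving-region ru ¬rv uv
    ... | inj₂ ¬ru | inj₁ rv rewrite recolour-out ¬ru | recolour-in rv =
      leaving-region rv ¬ru (adj-sym uv) ∘ sym
    ... | inj₂ ¬ru | inj₂ ¬rv rewrite recolour-out ¬ru | recolour-out ¬rv = outside-region ¬ru ¬rv uv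

  normalised : Σ (Colour → Colour) λ π →
               (∀ {c c'} → π c ≡ π c' → c ≡ c') × π (f b) ≡ zero × π (f a) ≡ suc zero
  normalised = normalise (f b) (f a) (f-proper b a (adj-sym (step (s≤s z≤n))) b-external a-external)

  π : Colour → Colour
  π = proj₁ normalised

  π-injective : ∀ {c c'} → π c ≡ π c' → c ≡ c'
  π-injective = proj₁ (proj₂ normalised)

  π-b : π (f b) ≡ zero
  π-b = proj₁ (proj₂ (proj₂ normalised))

  π-a : π (f a) ≡ suc zero
  π-a = proj₂ (proj₂ (proj₂ normalised))

  base : Fin N → Colour
  base v with internal? v
  ... | yes (t , _) = alternate (suc zero) t
  ... | no _ = π (f v)

  base-internal : ∀ {t} → 2 ≤ t → t < n → base (ψ t) ≡ alternate (suc zero) t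
  base-internal {t} 2≤t t<n with internal? (ψ t)
  ... | yes i = cong (alternate (suc zero)) (position i t<n)
  ... | no external = contradiction (internal-at 2≤t t<n) external

  base-external : ∀ {v} → ¬ Internal v → base v ≡ π (f v)
  base-external {v} external with internal? v
  ... | yes i = contradiction i external
  ... | no _ = refl

  -- base alternates along the whole walk ψ 1, …, ψ n, as b gets 0 and ψ n = a gets 1.
  base-walk : ∀ {t} → 1 ≤ t → t ≤ n → base (ψ t) ≡ alternate (suc zero) t
  base-walk {suc zero} _ _ = trans (base-external b-external) π-b
  base-walk {suc (suc t)} _ t≤n with m≤n⇒m<n∨m≡n t≤n
  ... | inj₁ t<n = base-internal (s≤s (s≤s z≤n)) t<n
  ... | inj₂ refl = begin
    base (ψ n)                            ≡⟨ cong base closed ⟩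
    base a                                ≡⟨ base-external a-external ⟩
    π (f a)                               ≡⟨ π-a ⟩
    suc zero                              ≡⟨ alternate-even (suc zero) j ⟨
    alternate (suc zero) (j + j)          ≡⟨ σ-involutive _ ⟨
    σ (σ (alternate (suc zero) (j + j)))  ≡⟨ σ-involutive _ ⟨
    alternate (suc zero) n                ∎
    where open ≡-Reasoning

  base-walk-edge : ∀ {t} → 1 ≤ t → t < n → base (ψ t) ≢ base (ψ (suc t))
  base-walk-edge {t} 1≤t t<n
    rewrite base-walk 1≤t (≤-trans (n≤1+n t) t<n) | base-walk (≤-trans 1≤t (n≤1+n t)) t<n =
    σ-moves-low (alternate-Low low₁ t) ∘ sym

  -- an edge at an internal vertex joins two consecutive vertices of the walk
  base-internal-edge : ∀ {u v} → Internal u → adj G u v ≡ true → base u ≢ base v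
  base-internal-edge (t , t<n , 2≤t , refl) uv with internal-neighbours 2≤t t<n uv
  base-internal-edge (suc t , t<n , s≤s 1≤t , refl) uv | inj₁ refl =
    base-walk-edge 1≤t (≤-trans (n≤1+n _) t<n) ∘ sym
  ... | inj₂ refl = base-walk-edge (≤-trans (s≤s z≤n) 2≤t) t<n

  base-proper : Proper base
  base-proper u v uv with toSum (internal? u) | toSum (internal? v)
  ... | inj₁ iu | _ = base-internal-edge iu uv
  ... | inj₂ _ | inj₁ iv = base-internal-edge iv (adj-sym uv) ∘ sym
  ... | inj₂ eu | inj₂ ev rewrite base-external eu | base-external ev =
    f-proper u v uv eu ev ∘ π-injective

  -- base is not a recoloured cover colouring: d would be low on the whole
  -- walk, so ψ (n-1) would be recoloured and d would repeat a colour on the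
  -- plain edge ψ (n-1) a.
  base-missed : ∀ d → CoverColouring d → ¬ (recolour d ≗ base)
  base-missed d colouring same = plain-edge colouring (step ≤-refl) last-untwisted (begin
    d (ψ last)                    ≡⟨ σ-involutive _ ⟨
    σ (σ (d (ψ last)))            ≡⟨ cong σ (recolour-in last-recoloured) ⟨
    σ (recolour d (ψ last))       ≡⟨ cong σ (same (ψ last)) ⟩
    σ (base (ψ last))             ≡⟨ cong σ (base-walk (s≤s z≤n) (n≤1+n _)) ⟩
    alternate (suc zero) n        ≡⟨ base-walk (s≤s z≤n) ≤-refl ⟨
    base (ψ n)                    ≡⟨ same (ψ n) ⟨
    recolour d (ψ n)              ≡⟨ recolour-out (λ r → a-external (subst Internal closed (proj₁ r))) ⟩
    d (ψ n)                       ∎)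
    where
    open ≡-Reasoning
    last : ℕ
    last = suc (suc (suc (j + j)))
    low-everywhere : ∀ v → Low (base v) → Low (d v)
    low-everywhere v low = recolour-Low⁻ d v (subst Low (sym (same v)) low)
    whole-walk : Prefix d last
    whole-walk = prefix λ {s} 1≤s s≤last → low-everywhere (ψ s)
      (subst Low (sym (base-walk 1≤s (≤-trans s≤last (n≤1+n _)))) (alternate-Low low₁ s))
    last-recoloured : Region d (ψ last)
    last-recoloured = region-at (s≤s (s≤s z≤n)) ≤-refl whole-walk
    last-untwisted : ¬ Twisted (ψ last) (ψ n)
    last-untwisted = untwisted (internal≢b (proj₁ last-recoloured)) (a≢b ∘ trans (sym closed))

  result : PDP-lt G (suc (suc m')) (P G (suc (suc m')))
  result = fewer-cover-colourings recolour (λ _ → recolour-proper) (λ _ _ _ _ → recolour-injective)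
                                  base base-proper base-missed

even-ear⇒PDP<P : ∀ {N j m'} {G : Graph N} (E : EvenEar G j) (f : Fin N → Fin (suc (suc m'))) →
  (∀ u v → adj G u v ≡ true → ¬ EvenEar.Internal E u → ¬ EvenEar.Internal E v → f u ≢ f v) →
  PDP-lt G (suc (suc m')) (P G (suc (suc m')))
even-ear⇒PDP<P E f f-proper = EarArgument.result E f f-proper

module Rotation (n : ℕ) .{{_ : NonZero n}} where

  %-absorbʳ : ∀ k x → (k + x % n) % n ≡ (k + x) % n
  %-absorbʳ k x = begin
    (k + x % n) % n            ≡⟨ %-distribˡ-+ k (x % n) n ⟩
    (k % n + x % n % n) % n    ≡⟨ cong (λ y → (k % n + y) % n) (m%n%n≡m%n x n) ⟩
    (k % n + x % n) % n        ≡⟨ %-distribˡ-+ k x n ⟨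
    (k + x) % n                ∎
    where open ≡-Reasoning

  %-absorbˡ : ∀ x k → (x % n + k) % n ≡ (x + k) % n
  %-absorbˡ x k = begin
    (x % n + k) % n   ≡⟨ cong (_% n) (+-comm (x % n) k) ⟩
    (k + x % n) % n   ≡⟨ %-absorbʳ k x ⟩
    (k + x) % n       ≡⟨ cong (_% n) (+-comm k x) ⟩
    (x + k) % n       ∎
    where open ≡-Reasoning

  full-turn : ∀ {P} i → P ≤ n → P + i + (n ∸ P) ≡ i + n
  full-turn {P} i P≤n = begin
    P + i + (n ∸ P)    ≡⟨ cong (_+ (n ∸ P)) (+-comm P i) ⟩
    i + P + (n ∸ P)    ≡⟨ +-assoc i P (n ∸ P) ⟩
    i + (P + (n ∸ P))  ≡⟨ cong (i +_) (m+[n∸m]≡n P≤n) ⟩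
    i + n              ∎
    where open ≡-Reasoning

  unrotate : ∀ {P s} → P ≤ n → s < n → ((P + s) % n + (n ∸ P)) % n ≡ s
  unrotate {P} {s} P≤n s<n = begin
    ((P + s) % n + (n ∸ P)) % n   ≡⟨ %-absorbˡ (P + s) (n ∸ P) ⟩
    (P + s + (n ∸ P)) % n         ≡⟨ cong (_% n) (full-turn s P≤n) ⟩
    (s + n) % n                   ≡⟨ [m+n]%n≡m%n s n ⟩
    s % n                         ≡⟨ m<n⇒m%n≡m s<n ⟩
    s                             ∎
    where open ≡-Reasoning

  rotate-injective : ∀ {P s t} → P ≤ n → s < n → t < n → (P + s) % n ≡ (P + t) % n → s ≡ t
  rotate-injective {P} P≤n s<n t<n eq =
    trans (sym (unrotate P≤n s<n)) (trans (cong (λ x → (x + (n ∸ P)) % n) eq) (unrotate P≤n t<n))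

  rotate-surjective : ∀ {P i} → P ≤ n → i < n → (P + (i + (n ∸ P)) % n) % n ≡ i
  rotate-surjective {P} {i} P≤n i<n = begin
    (P + (i + (n ∸ P)) % n) % n   ≡⟨ %-absorbʳ P (i + (n ∸ P)) ⟩
    (P + (i + (n ∸ P))) % n       ≡⟨ cong (_% n) (trans (sym (+-assoc P i (n ∸ P))) (full-turn i P≤n)) ⟩
    (i + n) % n                   ≡⟨ [m+n]%n≡m%n i n ⟩
    i % n                         ≡⟨ m<n⇒m%n≡m i<n ⟩
    i                             ∎
    where open ≡-Reasoning

record CyclicWalk {N : ℕ} (C : GraphIn N) (n : ℕ) : Set where
  field
    walk       : ℕ → Fin N
    closed     : walk n ≡ walk 0
    distinct   : ∀ {s t} → s < n → t < n → walk s ≡ walk t → s ≡ t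
    covers     : ∀ {v} → verts C v ≡ true → ∃ λ t → t < n × walk t ≡ v
    step       : ∀ t → eadj C (walk t) (walk (suc t)) ≡ true
    neighbours : ∀ {t v} → eadj C (walk (suc t)) v ≡ true → v ≡ walk t ⊎ v ≡ walk (suc (suc t))

module Walking {N l : ℕ} {C : GraphIn N} (cycle : IsCycle (suc l) C) (p : Fin (suc l)) where

  open Rotation (suc l)

  n : ℕ
  n = suc l

  φ : Fin n → Fin N
  φ = proj₁ cycle

  φ-injective : ∀ {i i'} → φ i ≡ φ i' → i ≡ i'
  φ-injective = proj₁ (proj₂ cycle)

  φ-onto : ∀ v → verts C v ≡ true → ∃ λ i → φ i ≡ v
  φ-onto = proj₁ (proj₂ (proj₂ (proj₂ cycle)))

  φ-edge⁻ : ∀ i i' → eadj C (φ i) (φ i') ≡ true → cycAdj n i i'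
  φ-edge⁻ = proj₁ (proj₂ (proj₂ (proj₂ (proj₂ cycle))))

  φ-edge⁺ : ∀ i i' → cycAdj n i i' → eadj C (φ i) (φ i') ≡ true
  φ-edge⁺ = proj₂ (proj₂ (proj₂ (proj₂ (proj₂ cycle))))

  start : ℕ
  start = toℕ p

  position : ℕ → Fin n
  position t = fromℕ< (m%n<n (start + t) n)

  toℕ-position : ∀ t → toℕ (position t) ≡ (start + t) % n
  toℕ-position t = toℕ-fromℕ< (m%n<n (start + t) n)

  ψ : ℕ → Fin N
  ψ t = φ (position t)

  position-suc : ∀ t → toℕ (position (suc t)) ≡ suc (toℕ (position t)) % n
  position-suc t = begin
    toℕ (position (suc t))       ≡⟨ toℕ-position (suc t) ⟩
    (start + suc t) % n              ≡⟨ cong (_% n) (+-suc start t) ⟩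
    (1 + (start + t)) % n            ≡⟨ %-absorbʳ 1 (start + t) ⟨
    (1 + (start + t) % n) % n        ≡⟨ cong (λ x → suc x % n) (toℕ-position t) ⟨
    suc (toℕ (position t)) % n   ∎
    where open ≡-Reasoning

  position-0 : position 0 ≡ p
  position-0 = toℕ-injective
    (trans (toℕ-position 0) (trans (cong (_% n) (+-identityʳ start)) (m<n⇒m%n≡m (toℕ<n p))))

  position-n : position n ≡ p
  position-n = toℕ-injective (trans (toℕ-position n) (trans ([m+n]%n≡m%n start n) (m<n⇒m%n≡m (toℕ<n p))))

  -- ψ is a walk once around C: distinctness and covering come from rotating
  -- the positions, neighbourhoods from the cycle adjacency of φ.
  walk : CyclicWalk C n
  walk = record
    { walk = ψ
    ; closed = cong φ (trans position-n (sym position-0))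
    ; distinct = λ s<n t<n ψs≡ψt → rotate-injective (<⇒≤ (toℕ<n p)) s<n t<n
        (trans (sym (toℕ-position _)) (trans (cong toℕ (φ-injective ψs≡ψt)) (toℕ-position _)))
    ; covers = covers
    ; step = λ t → φ-edge⁺ (position t) (position (suc t)) (inj₁ (position-suc t))
    ; neighbours = neighbours
    }
    where
    covers : ∀ {v} → verts C v ≡ true → ∃ λ t → t < n × ψ t ≡ v
    covers {v} v∈C with φ-onto v v∈C
    ... | i , refl = (toℕ i + (n ∸ start)) % n , m%n<n (toℕ i + (n ∸ start)) n ,
      cong φ (toℕ-injective (trans (toℕ-position _) (rotate-surjective (<⇒≤ (toℕ<n p)) (toℕ<n i))))
    neighbours : ∀ {t v} → eadj C (ψ (suc t)) v ≡ true → v ≡ ψ t ⊎ v ≡ ψ (suc (suc t))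
    neighbours {t} {v} edge with φ-onto v (eInVerts C v (ψ (suc t)) (trans (esym C v (ψ (suc t))) edge))
    ... | i , refl with φ-edge⁻ (position (suc t)) i edge
    ...   | inj₁ forwards = inj₂ (cong φ (toℕ-injective (trans forwards (sym (position-suc (suc t))))))
    ...   | inj₂ backwards = inj₁ (cong φ (toℕ-injective (rotate-injective (s≤s z≤n) (toℕ<n i) (toℕ<n (position t))
              (trans (sym backwards) (position-suc t)))))

  walk-0 : ψ 0 ≡ φ p
  walk-0 = cong φ position-0

  walk-1 : ∀ {q} → toℕ q ≡ suc (toℕ p) % n → ψ 1 ≡ φ q
  walk-1 {q} q-next = cong φ (toℕ-injective (trans (position-suc 0)
                        (trans (cong (λ i → suc (toℕ i) % n) position-0) (sym q-next))))

edge-walk : ∀ {N l} {C : GraphIn N} → IsCycle (suc l) C → ∀ {x y} → eadj C x y ≡ true →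
  Σ (CyclicWalk C (suc l)) λ W → let open CyclicWalk W in
    (walk 0 ≡ x × walk 1 ≡ y) ⊎ (walk 0 ≡ y × walk 1 ≡ x)
edge-walk {C = C} cycle@(_ , _ , _ , onto , edge⁻ , _) {x} {y} xy
  with onto x (eInVerts C x y xy) | onto y (eInVerts C y x (trans (esym C y x) xy))
... | p , refl | q , refl with edge⁻ p q xy
... | inj₁ q-next = W.walk , inj₁ (W.walk-0 , W.walk-1 q-next)
  where module W = Walking {C = C} cycle p
... | inj₂ p-next = W.walk , inj₂ (W.walk-0 , W.walk-1 p-next)
  where module W = Walking {C = C} cycle q

-- The clique-sum of a cycle G₁ and a graph G₂ sharing the edge ψ 0 ψ 1 of a
-- walk ψ around G₁: the walk is an even ear of G₁ ⊕ G₂ (its internal vertices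
-- lie outside G₂), and off that ear every edge is an edge of G₂ or the shared
-- edge, so a colouring of G₂ is proper there.
module CliqueSumEar {N j : ℕ} (G₁ G₂ : GraphIn N) (W : CyclicWalk G₁ (earLength j))
  (shared : ∀ v → (verts G₁ v ∧ verts G₂ v) ≡ true → v ≡ CyclicWalk.walk W 0 ⊎ v ≡ CyclicWalk.walk W 1)
  (ends-adjacent : eadj G₂ (CyclicWalk.walk W 0) (CyclicWalk.walk W 1) ≡ true) where

  open CyclicWalk W

  n : ℕ
  n = earLength j

  G : Graph N
  G = cliqueSum G₁ G₂

  End : Fin N → Set
  End v = v ≡ walk 0 ⊎ v ≡ walk 1

  internal-not-end : ∀ {t} → 2 ≤ t → t < n → ¬ End (walk t)
  internal-not-end (s≤s (s≤s _)) t<n (inj₁ ψt≡ψ0) with distinct t<n (s≤s z≤n) ψt≡ψ0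
  ... | ()
  internal-not-end (s≤s (s≤s _)) t<n (inj₂ ψt≡ψ1) with distinct t<n (s≤s (s≤s z≤n)) ψt≡ψ1
  ... | ()

  adj₁ : ∀ {u v} → eadj G₁ u v ≡ true → adj G u v ≡ true
  adj₁ uv rewrite uv = refl

  adj-parts : ∀ {u v} → adj G u v ≡ true → eadj G₁ u v ≡ true ⊎ eadj G₂ u v ≡ true
  adj-parts uv = ∨-true uv

  -- internal vertices of the walk are not in G₂, so their neighbours are those on the walk
  internal-neighbours : ∀ {t v} → 2 ≤ t → t < n → adj G (walk t) v ≡ true →
                        v ≡ walk (pred t) ⊎ v ≡ walk (suc t)
  internal-neighbours {suc t} {v} 2≤t t<n ψt~v with adj-parts ψt~v
  ... | inj₁ in-G₁ = neighbours in-G₁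
  ... | inj₂ in-G₂ = contradiction (shared (walk (suc t)) both) (internal-not-end 2≤t t<n)
    where
    both : (verts G₁ (walk (suc t)) ∧ verts G₂ (walk (suc t))) ≡ true
    both rewrite eInVerts G₁ _ _ (step (suc t)) | eInVerts G₂ _ v in-G₂ = refl

  ear : EvenEar G j
  ear = record
    { walk = walk
    ; closed = closed
    ; distinct = distinct
    ; step = λ {t} _ → adj₁ (step t)
    ; internal-neighbours = internal-neighbours
    }

  open EvenEar ear using (Internal)

  external-end : ∀ {v} → verts G₁ v ≡ true → ¬ Internal v → End v
  external-end v∈G₁ external with covers v∈G₁
  ... | zero , _ , refl = inj₁ refl
  ... | suc zero , _ , refl = inj₂ refl
  ... | suc (suc s) , s<n , refl = contradiction (suc (suc s) , s<n , s≤s (s≤s z≤n) , refl) external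

  -- a colouring of G₂ is proper on every edge of G avoiding the ear's internal
  -- vertices: such an edge lies in G₂ or joins the two ends
  proper-off-ear : ∀ {m} (f : Fin N → Fin m) → (∀ u v → eadj G₂ u v ≡ true → f u ≢ f v) →
    ∀ u v → adj G u v ≡ true → ¬ Internal u → ¬ Internal v → f u ≢ f v
  proper-off-ear f f-proper u v uv eu ev with adj-parts uv
  ... | inj₂ in-G₂ = f-proper u v in-G₂
  ... | inj₁ in-G₁ with external-end (eInVerts G₁ u v in-G₁) eu
                      | external-end (eInVerts G₁ v u (trans (esym G₁ v u) in-G₁)) ev
  ...   | inj₁ refl | inj₁ refl = contradiction (trans (sym (eirrefl G₁ u)) in-G₁) λ ()
  ...   | inj₁ refl | inj₂ refl = f-proper u v ends-adjacent
  ...   | inj₂ refl | inj₁ refl = f-proper u v (trans (esym G₂ u v) ends-adjacent)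
  ...   | inj₂ refl | inj₂ refl = contradiction (trans (sym (eirrefl G₁ u)) in-G₁) λ ()

-- C_{2k+2} with k = j + 1 is the ear length 2j + 4.
cycle-length : ∀ j → 2 * suc j + 2 ≡ suc (suc (suc (suc (j + j))))
cycle-length = solve-∀

oriented-ends : ∀ {N} {x y a b : Fin N} → (x ≡ a × y ≡ b) ⊎ (x ≡ b × y ≡ a) →
  ∀ {v} → v ≡ a ⊎ v ≡ b → v ≡ x ⊎ v ≡ y
oriented-ends (inj₁ (refl , refl)) v≡ = v≡
oriented-ends (inj₂ (refl , refl)) (inj₁ v≡a) = inj₂ v≡a
oriented-ends (inj₂ (refl , refl)) (inj₂ v≡b) = inj₁ v≡b

oriented-edge : ∀ {N} (G₂ : GraphIn N) {x y a b : Fin N} → (x ≡ a × y ≡ b) ⊎ (x ≡ b × y ≡ a) →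
  eadj G₂ a b ≡ true → eadj G₂ x y ≡ true
oriented-edge G₂ (inj₁ (refl , refl)) ab = ab
oriented-edge G₂ {a = a} {b} (inj₂ (refl , refl)) ab = trans (esym G₂ b a) ab

-- Theorem 2.4.  Write k = j + 1 and m = m' + 2; the walk around G₁ starting
-- with the edge ab is an even ear of the clique-sum, and the colouring f of G₂
-- is proper off the ear.
theorem2p4 : (k : ℕ) → 1 ≤ k → (N : ℕ) → (G₁ G₂ : GraphIn N) →
    IsCycle (2 * k + 2) G₁ →
    (∀ v → (verts G₁ v ∨ verts G₂ v) ≡ true) →
    (a b : Fin N) → a ≢ b →
    (∀ v → (verts G₁ v ∧ verts G₂ v) ≡ true → v ≡ a ⊎ v ≡ b) →
    verts G₁ a ≡ true → verts G₂ a ≡ true →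
    verts G₁ b ≡ true → verts G₂ b ≡ true →
    eadj G₁ a b ≡ true → eadj G₂ a b ≡ true →
    (m : ℕ) → 2 ≤ m → Colorable G₂ m →
    PDP-lt (cliqueSum G₁ G₂) m (P (cliqueSum G₁ G₂) m)
theorem2p4 zero () _ _ _ _ _ _ _ _ _ _ _ _ _ _ _ _ _ _
theorem2p4 (suc j) _ _ _ _ _ _ _ _ _ _ _ _ _ _ _ _ zero () _
theorem2p4 (suc j) _ _ _ _ _ _ _ _ _ _ _ _ _ _ _ _ (suc zero) (s≤s ()) _
theorem2p4 (suc j) _ N G₁ G₂ cycle _ a b _ shared _ _ _ _ ab₁ ab₂ (suc (suc m')) _ (f , f-proper)
  with edge-walk (subst (λ n → IsCycle n G₁) (cycle-length j) cycle) ab₁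
... | W , starts = even-ear⇒PDP<P ear f (proper-off-ear f f-proper)
  where open CliqueSumEar {j = j} G₁ G₂ W (λ v v∈ → oriented-ends starts (shared v v∈))
                                           (oriented-edge G₂ starts ab₂)
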